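{- For every integer $n \ge 1$, $\lambda(n) \le 2\sqrt{n}$.
   Context: All posets are finite. A linear extension of a poset $P=(X,\preceq)$ is a total ordering of $X$ compatible with $\preceq$; $e(P)$ denotes the number of linear extensions of $P$. The size $|P|$ of $P$ is $|X|$. For an integer $n\ge 1$, $\lambda(n)=\min\{|P| : e(P)=n\}$ (the empty poset has exactly one linear extension, so $\lambda(1)=0$). -}

module Defs where

open import Data.Nat using (ℕ; zero; suc)
open import Data.Bool using (Bool; T)
open import Data.Fin using (Fin; _≤_; _≤?_; _≟_)
open import Data.Fin.Properties using (all?)
open import Data.Vec using (Vec; []; _∷_; lookup)
open import Data.List using (List; [_]; concatMap; map; filter; length; allFin)
open import Data.Product using (_×_)
open import Relation.Binary.PropositionalEquality using (_≡_)
open import Relation.Nullary using (Dec; yes; no; _→-dec_)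
open import Relation.Nullary.Decidable using (_×-dec_)
open import Data.Bool.Properties using (T?)

record FinPoset (k : ℕ) : Set where
  field
    _≼_     : Fin k → Fin k → Bool
    ≼-refl  : ∀ x → T (x ≼ x)
    ≼-antisym : ∀ x y → T (x ≼ y) → T (y ≼ x) → x ≡ y
    ≼-trans : ∀ x y z → T (x ≼ y) → T (y ≼ z) → T (x ≼ z)
open FinPoset public

-- A linear extension is a listing w(0), …, w(k-1) of all elements
-- (injective, hence a bijection Fin k → Fin k, position ↦ element)
-- such that x ≼ y implies x occurs no later than y.
IsLinExt : ∀ {k} → FinPoset k → Vec (Fin k) k → Set
IsLinExt P w =
  (∀ i j → lookup w i ≡ lookup w j → i ≡ j) ×
  (∀ i j → T (_≼_ P (lookup w i) (lookup w j)) → i ≤ j)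

isLinExt? : ∀ {k} (P : FinPoset k) (w : Vec (Fin k) k) → Dec (IsLinExt P w)
isLinExt? P w =
  all? (λ i → all? (λ j → (lookup w i ≟ lookup w j) →-dec (i ≟ j)))
  ×-dec
  all? (λ i → all? (λ j → T? (_≼_ P (lookup w i) (lookup w j)) →-dec (i ≤? j)))

allVecs : ∀ k m → List (Vec (Fin k) m)
allVecs k zero = [ [] ]
allVecs k (suc m) = concatMap (λ x → map (x ∷_) (allVecs k m)) (allFin k)

e : ∀ {k} → FinPoset k → ℕ
e {k} P = length (filter (isLinExt? P) (allVecs k k))

module Submission where

-- The posets used form a three-parameter family P(A,g,B): a chain
-- c₀ < … < c_{m-1} of length m = A + g + B together with two further points,
-- x below c_{A+g} and y above c_{A-1}.  A linear extension inserts x into one of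
-- the A+g+1 gaps up to c_{A+g} and y into one of the g+B+1 gaps after c_{A-1};
-- when both fall into one of the g+1 common gaps they can be ordered in two ways,
-- so e(P(A,g,B)) = (A+g+1)(g+B+1) + (g+1).  Writing n = s² + r with 0 ≤ r ≤ 2s,
-- suitable A, g, B give e = n and |P| = A+g+B+2 ≤ 2√n.

open import Defs
open import Data.Nat using (ℕ; zero; suc; _+_; _*_; _≤_; _<_; _≤ᵇ_; _<ᵇ_; z≤n; s≤s; _≤?_; _<?_)
open import Data.Nat.Properties
  using ( +-identityʳ; +-assoc; +-suc; m≤m+n; m<m+n; ≤-refl; ≤-trans; ≤-antisym; <-trans
        ; <-irrefl; <-≤-trans; ≤-<-trans; <⇒≤; ≤-pred; m≤n⇒m≤1+n; m<n⇒m<1+n; <-cmp; 1+n≰n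
        ; ≰⇒>; ≮⇒≥; +-cancelˡ-<; m≤n⇒∃[o]m+o≡n; ≤ᵇ⇒≤; ≤⇒≤ᵇ; <ᵇ⇒<; <⇒<ᵇ )
open import Data.Nat.Tactic.RingSolver using (solve-∀)
open import Data.Bool using (Bool; true; false; T; not; _∧_; _∨_; if_then_else_)
open import Data.Bool.Properties using (T-∧; T-∨; ∧-identityʳ; ∧-zeroʳ; ∨-zeroʳ)
open import Data.Unit using (tt)
open import Data.Empty using (⊥-elim)
open import Data.Fin using (Fin; zero; suc; toℕ; punchOut; fromℕ<)
open import Data.Fin.Properties
  using (_≟_; any?; suc-injective; toℕ-injective; toℕ-fromℕ<; toℕ<n; injective⇒≤; punchOut-injective)
import Data.Fin as Fin
open import Data.Vec using (Vec; []; _∷_; lookup)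
open import Data.List using (List; []; _∷_; map; filter; length; tabulate; _++_; concat)
open import Data.List.Properties using (filter-accept; filter-reject)
open import Data.Product using (Σ; ∃; ∃-syntax; _×_; _,_; proj₁; proj₂)
open import Data.Sum using (_⊎_; inj₁; inj₂)
open import Function using (_∘_)
open import Function.Bundles using (Equivalence)
open Equivalence using (to; from)
open import Relation.Binary using (tri<; tri≈; tri>)
open import Relation.Binary.PropositionalEquality using (_≡_; refl; sym; trans; cong; cong₂; subst; _≢_; module ≡-Reasoning)
open import Relation.Nullary using (yes; no; ¬_; does)
open import Relation.Nullary.Decidable using (dec-true; dec-false)

bool-ext : ∀ {a b} → (T a → T b) → (T b → T a) → a ≡ b
bool-ext {false} {false} f g = refl
bool-ext {false} {true}  f g = ⊥-elim (g tt)
bool-ext {true}  {false} f g = ⊥-elim (f tt)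
bool-ext {true}  {true}  f g = refl

T⇒true : ∀ {b} → T b → b ≡ true
T⇒true {true} _ = refl

true⇒T : ∀ {b} → b ≡ true → T b
true⇒T refl = tt

¬T⇒false : ∀ {b} → ¬ T b → b ≡ false
¬T⇒false {false} _ = refl
¬T⇒false {true}  h = ⊥-elim (h tt)

∨-falseˡ : ∀ {a b} → a ∨ b ≡ false → a ≡ false
∨-falseˡ {false} _ = refl

∨-falseʳ : ∀ {a b} → a ∨ b ≡ false → b ≡ false
∨-falseʳ {false} h = h

-- Boolean views of the order on ℕ, as equations usable by `rewrite`.
≤ᵇ-true : ∀ {a b} → a ≤ b → (a ≤ᵇ b) ≡ true
≤ᵇ-true = T⇒true ∘ ≤⇒≤ᵇ

≤ᵇ-false : ∀ {a b} → b < a → (a ≤ᵇ b) ≡ false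
≤ᵇ-false {a} {b} b<a = ¬T⇒false (λ h → <-irrefl refl (<-≤-trans b<a (≤ᵇ⇒≤ a b h)))

<ᵇ-true : ∀ {a b} → a < b → (a <ᵇ b) ≡ true
<ᵇ-true = T⇒true ∘ <⇒<ᵇ

<ᵇ-false : ∀ {a b} → ¬ a < b → (a <ᵇ b) ≡ false
<ᵇ-false {a} {b} a≮b = ¬T⇒false (a≮b ∘ <ᵇ⇒< a b)

-- allᶠ f is the conjunction of f over Fin n.  Unlike the Dec-valued `all?` it
-- computes by recursion on n, so the explicit evaluations below reduce.
allᶠ : ∀ {n} → (Fin n → Bool) → Bool
allᶠ {zero}  f = true
allᶠ {suc n} f = f zero ∧ allᶠ (f ∘ suc)

allᶠ-intro : ∀ {n} (f : Fin n → Bool) → (∀ i → T (f i)) → T (allᶠ f)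
allᶠ-intro {zero}  f h = tt
allᶠ-intro {suc n} f h = from T-∧ (h zero , allᶠ-intro (f ∘ suc) (h ∘ suc))

allᶠ-elim : ∀ {n} (f : Fin n → Bool) → T (allᶠ f) → ∀ i → T (f i)
allᶠ-elim {suc n} f h zero    = proj₁ (to T-∧ h)
allᶠ-elim {suc n} f h (suc i) = allᶠ-elim (f ∘ suc) (proj₂ (to (T-∧ {f zero}) h)) i

allᶠ-cong : ∀ {n} (f g : Fin n → Bool) → (∀ i → f i ≡ g i) → allᶠ f ≡ allᶠ g
allᶠ-cong {zero}  f g h = refl
allᶠ-cong {suc n} f g h = cong₂ _∧_ (h zero) (allᶠ-cong (f ∘ suc) (g ∘ suc) (h ∘ suc))

allᶠ-true : ∀ {n} → allᶠ {n} (λ _ → true) ≡ true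
allᶠ-true {zero}  = refl
allᶠ-true {suc n} = allᶠ-true {n}

sumᶠ : ∀ {n} → (Fin n → ℕ) → ℕ
sumᶠ {zero}  f = 0
sumᶠ {suc n} f = f zero + sumᶠ (f ∘ suc)

sumᶠ-cong : ∀ {n} (f g : Fin n → ℕ) → (∀ i → f i ≡ g i) → sumᶠ f ≡ sumᶠ g
sumᶠ-cong {zero}  f g h = refl
sumᶠ-cong {suc n} f g h = cong₂ _+_ (h zero) (sumᶠ-cong (f ∘ suc) (g ∘ suc) (h ∘ suc))

sumᶠ-zero : ∀ {n} (f : Fin n → ℕ) → (∀ i → f i ≡ 0) → sumᶠ f ≡ 0
sumᶠ-zero {zero}  f h = refl
sumᶠ-zero {suc n} f h rewrite h zero = sumᶠ-zero (f ∘ suc) (h ∘ suc)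

sumᶠ-single : ∀ {n} (f : Fin n → ℕ) (j : Fin n) → (∀ i → i ≢ j → f i ≡ 0) → sumᶠ f ≡ f j
sumᶠ-single {suc n} f zero h
  rewrite sumᶠ-zero (f ∘ suc) (λ i → h (suc i) (λ ())) = +-identityʳ (f zero)
sumᶠ-single {suc n} f (suc j) h
  rewrite h zero (λ ()) = sumᶠ-single (f ∘ suc) j (λ i i≢j → h (suc i) (i≢j ∘ suc-injective))

count : ∀ {A : Set} → (A → Bool) → List A → ℕ
count p []       = 0
count p (x ∷ xs) = (if p x then 1 else 0) + count p xs

count-++ : ∀ {A : Set} (p : A → Bool) (xs ys : List A) → count p (xs ++ ys) ≡ count p xs + count p ys
count-++ p []       ys = refl
count-++ p (x ∷ xs) ys rewrite count-++ p xs ys = sym (+-assoc (if p x then 1 else 0) _ _)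

count-map : ∀ {A B : Set} (p : B → Bool) (f : A → B) (xs : List A) → count p (map f xs) ≡ count (p ∘ f) xs
count-map p f []       = refl
count-map p f (x ∷ xs) = cong ((if p (f x) then 1 else 0) +_) (count-map p f xs)

count-cong : ∀ {A : Set} (p q : A → Bool) (xs : List A) → (∀ x → p x ≡ q x) → count p xs ≡ count q xs
count-cong p q []       h = refl
count-cong p q (x ∷ xs) h rewrite h x = cong ((if q x then 1 else 0) +_) (count-cong p q xs h)

count-guard : ∀ {A : Set} (b : Bool) (p : A → Bool) (xs : List A) →
  count (λ x → b ∧ p x) xs ≡ (if b then count p xs else 0)
count-guard false p []       = refl
count-guard true  p []       = refl
count-guard false p (x ∷ xs) = count-guard false p xs
count-guard true  p (x ∷ xs) = cong ((if p x then 1 else 0) +_) (count-guard true p xs)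

count-concat : ∀ {A B : Set} {n} (p : A → Bool) (f : B → List A) (h : Fin n → B) →
  count p (concat (map f (tabulate h))) ≡ sumᶠ (λ i → count p (f (h i)))
count-concat {n = zero}  p f h = refl
count-concat {n = suc n} p f h
  rewrite count-++ p (f (h zero)) (concat (map f (tabulate (h ∘ suc)))) =
  cong (count p (f (h zero)) +_) (count-concat p f (h ∘ suc))

-- An injective map Fin n → Fin n is surjective (otherwise it would inject
-- Fin n into Fin (n - 1)).
injective⇒surjective : ∀ {n} (f : Fin n → Fin n) → (∀ i j → f i ≡ f j → i ≡ j) → ∀ v → ∃ λ i → f i ≡ v
injective⇒surjective {zero}  f inj ()
injective⇒surjective {suc n} f inj v with any? (λ i → f i ≟ v)
... | yes hit = hit
... | no miss = ⊥-elim (1+n≰n (injective⇒≤ {f = squeeze} squeeze-injective))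
  where
    squeeze : Fin (suc n) → Fin n
    squeeze i = punchOut {i = v} {j = f i} (λ eq → miss (i , sym eq))
    squeeze-injective : ∀ {i j} → squeeze i ≡ squeeze j → i ≡ j
    squeeze-injective {i} {j} eq =
      inj i j (punchOut-injective {i = v} (λ e → miss (i , sym e)) (λ e → miss (j , sym e)) eq)

-- Counting the linear extensions of an arbitrary finite poset by listing it
-- element by element.  A listing in progress is described by the set U of
-- elements already listed; an element may be listed next when it is not in U
-- and all of its predecessors are.
module Completions {k : ℕ} (P : FinPoset k) where

  _≼ᵇ_ : Fin k → Fin k → Bool
  _≼ᵇ_ = _≼_ P

  Subset : Set
  Subset = Fin k → Bool

  addable : Subset → Fin k → Bool
  addable U z = not (U z) ∧ allᶠ (λ v → not (v ≼ᵇ z) ∨ (does (v ≟ z) ∨ U v))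

  add : Subset → Fin k → Subset
  add U z v = does (v ≟ z) ∨ U v

  continues : ∀ {t} → Subset → Vec (Fin k) t → Bool
  continues U []      = true
  continues U (z ∷ w) = addable U z ∧ continues (add U z) w

  completions : ℕ → Subset → ℕ
  completions t U = count (continues U) (allVecs k t)

  completions-suc : ∀ t U →
    completions (suc t) U ≡ sumᶠ (λ z → if addable U z then completions t (add U z) else 0)
  completions-suc t U =
    trans (count-concat (continues U) (λ z → map (z ∷_) (allVecs k t)) (λ z → z))
          (sumᶠ-cong _ _ λ z →
            trans (count-map (continues U) (z ∷_) (allVecs k t))
                  (count-guard (addable U z) (continues (add U z)) (allVecs k t)))

  addable-cong : ∀ U V → (∀ v → U v ≡ V v) → ∀ z → addable U z ≡ addable V z
  addable-cong U V U≗V z = cong₂ (λ a b → not a ∧ b) (U≗V z)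
    (allᶠ-cong _ _ λ v → cong (λ c → not (v ≼ᵇ z) ∨ (does (v ≟ z) ∨ c)) (U≗V v))

  continues-cong : ∀ {t} U V → (∀ v → U v ≡ V v) → (w : Vec (Fin k) t) → continues U w ≡ continues V w
  continues-cong U V U≗V []      = refl
  continues-cong U V U≗V (z ∷ w) = cong₂ _∧_ (addable-cong U V U≗V z)
    (continues-cong (add U z) (add V z) (λ v → cong (does (v ≟ z) ∨_) (U≗V v)) w)

  completions-cong : ∀ t U V → (∀ v → U v ≡ V v) → completions t U ≡ completions t V
  completions-cong t U V U≗V = count-cong _ _ (allVecs k t) (continues-cong U V U≗V)

  Avoids : ∀ {t} → Subset → Vec (Fin k) t → Set
  Avoids U w = ∀ i → U (lookup w i) ≡ false

  Injective : ∀ {t} → Vec (Fin k) t → Set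
  Injective w = ∀ i j → lookup w i ≡ lookup w j → i ≡ j

  OrderPreserving : ∀ {t} → Vec (Fin k) t → Set
  OrderPreserving w = ∀ i j → T (lookup w i ≼ᵇ lookup w j) → i Fin.≤ j

  continues-sound : ∀ {t} U (w : Vec (Fin k) t) → T (continues U w) →
    Avoids U w × Injective w × OrderPreserving w
  continues-sound U []      _ = (λ ()) , (λ ()) , (λ ())
  continues-sound U (z ∷ w) h = avoids , injective , ordered
    where
      z-addable = proj₁ (to (T-∧ {addable U z}) h)
      rest      = continues-sound (add U z) w (proj₂ (to (T-∧ {addable U z}) h))
      z∉U : U z ≡ false
      z∉U with U z | proj₁ (to (T-∧ {not (U z)}) z-addable)
      ... | false | _ = refl
      preds-listed = proj₂ (to (T-∧ {not (U z)}) z-addable)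
      avoids : Avoids U (z ∷ w)
      avoids zero    = z∉U
      avoids (suc i) = ∨-falseʳ (proj₁ rest i)
      later-≢-z : ∀ j → lookup w j ≢ z
      later-≢-z j eq with trans (sym (trans (cong (λ x → does (x ≟ z)) eq) (dec-true (z ≟ z) refl)))
                             (∨-falseˡ {does (lookup w j ≟ z)} (proj₁ rest j))
      ... | ()
      injective : Injective (z ∷ w)
      injective zero    zero    _  = refl
      injective zero    (suc j) eq = ⊥-elim (later-≢-z j (sym eq))
      injective (suc i) zero    eq = ⊥-elim (later-≢-z i eq)
      injective (suc i) (suc j) eq = cong suc (proj₁ (proj₂ rest) i j eq)
      -- a later element below z would have to be z or in U
      ordered : OrderPreserving (z ∷ w)
      ordered zero    j       _ = z≤n
      ordered (suc i) (suc j) h = s≤s (proj₂ (proj₂ rest) i j h)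
      ordered (suc i) zero    h with allᶠ-elim _ preds-listed (lookup w i)
      ... | listed with lookup w i ≼ᵇ z
      ... | true with does (lookup w i ≟ z) ∨ U (lookup w i) | proj₁ rest i
      ...   | false | _ = ⊥-elim listed

  continues-complete : ∀ {t} U (w : Vec (Fin k) t) → Avoids U w → Injective w → OrderPreserving w →
    (∀ v → T (U v) ⊎ ∃ λ i → lookup w i ≡ v) → T (continues U w)
  continues-complete U []      _ _ _ _ = tt
  continues-complete U (z ∷ w) avoids inj ord covers =
    from (T-∧ {addable U z}) (from (T-∧ {not (U z)}) (z∉U , preds-listed) , rest)
    where
      z∉U : T (not (U z))
      z∉U rewrite avoids zero = tt
      pred-listed : ∀ v b → v ≼ᵇ z ≡ b → T (not b ∨ (does (v ≟ z) ∨ U v))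
      pred-listed v false _ = tt
      pred-listed v true v≼z with covers v
      ... | inj₁ v∈U = from (T-∨ {does (v ≟ z)}) (inj₂ v∈U)
      ... | inj₂ (zero , refl) rewrite dec-true (z ≟ z) refl = tt
      ... | inj₂ (suc i , eq) with ord (suc i) zero (subst T (sym (trans (cong (_≼ᵇ z) eq) v≼z)) tt)
      ... | ()
      preds-listed : T (allᶠ (λ v → not (v ≼ᵇ z) ∨ (does (v ≟ z) ∨ U v)))
      preds-listed = allᶠ-intro _ λ v → pred-listed v (v ≼ᵇ z) refl
      later-≢-z : ∀ j → lookup w j ≢ z
      later-≢-z j eq with inj (suc j) zero eq
      ... | ()
      avoids′ : Avoids (add U z) w
      avoids′ j rewrite dec-false (lookup w j ≟ z) (later-≢-z j) | avoids (suc j) = refl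
      covers′ : ∀ v → T (add U z v) ⊎ ∃ λ i → lookup w i ≡ v
      covers′ v with covers v
      ... | inj₁ v∈U = inj₁ (from (T-∨ {does (v ≟ z)}) (inj₂ v∈U))
      ... | inj₂ (zero , refl) rewrite dec-true (z ≟ z) refl = inj₁ tt
      ... | inj₂ (suc i , eq) = inj₂ (i , eq)
      rest : T (continues (add U z) w)
      rest = continues-complete (add U z) w avoids′ (λ i j eq → suc-injective (inj (suc i) (suc j) eq))
        (λ i j h → ≤-pred (ord (suc i) (suc j) h)) covers′

  linExts≡continuations : (ws : List (Vec (Fin k) k)) →
    length (filter (isLinExt? P) ws) ≡ count (continues (λ _ → false)) ws
  linExts≡continuations [] = refl
  linExts≡continuations (w ∷ ws) with isLinExt? P w | continues (λ _ → false) w in eqw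
  ... | yes le | true rewrite filter-accept (isLinExt? P) {x = w} {xs = ws} le =
    cong suc (linExts≡continuations ws)
  ... | yes (inj , ord) | false
    with continues-complete (λ _ → false) w (λ _ → refl) inj ord
           (λ v → inj₂ (injective⇒surjective (lookup w) inj v))
  ... | h rewrite eqw = ⊥-elim h
  linExts≡continuations (w ∷ ws) | no ¬le | false
    rewrite filter-reject (isLinExt? P) {x = w} {xs = ws} ¬le = linExts≡continuations ws
  linExts≡continuations (w ∷ ws) | no ¬le | true
    with continues-sound (λ _ → false) w (true⇒T eqw)
  ... | _ , inj , ord = ⊥-elim (¬le (inj , ord))

  e≡completions : e P ≡ completions k (λ _ → false)
  e≡completions = linExts≡continuations (allVecs k k)

-- Arithmetic bookkeeping for walking along the chain: position i with d further
-- steps to reach n.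
before : ∀ {i d n} → i + suc d ≡ n → i < n
before {i} eq = subst (i <_) eq (m<m+n i (s≤s z≤n))

at : ∀ {i n} → i + 0 ≡ n → i ≡ n
at {i} eq = trans (sym (+-identityʳ i)) eq

step-along : ∀ {i d n} → i + suc d ≡ n → suc i + d ≡ n
step-along {i} {d} eq = trans (sym (+-suc i d)) eq

extend-sum : ∀ i e d {c} → i + e ≡ c → i + (e + d) ≡ c + d
extend-sum i e d eq = trans (sym (+-assoc i e d)) (cong (_+ d) eq)

-- Its ground set Fin (m + 2), m = A + g + B, consists of
-- the low point x = zero, the high point y = suc zero and the chain elements
-- c_j = suc (suc j), j < m.
module Family (A g B : ℕ) where

  m : ℕ
  m = A + g + B

  rel : Fin (2 + m) → Fin (2 + m) → Bool
  rel zero           zero            = true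
  rel zero           (suc zero)      = false
  rel zero           (suc (suc j))   = A + g ≤ᵇ toℕ j
  rel (suc zero)     zero            = false
  rel (suc zero)     (suc zero)      = true
  rel (suc zero)     (suc (suc j))   = false
  rel (suc (suc j))  zero            = false
  rel (suc (suc j))  (suc zero)      = toℕ j <ᵇ A
  rel (suc (suc j))  (suc (suc j′))  = toℕ j ≤ᵇ toℕ j′

  rel-refl : ∀ u → T (rel u u)
  rel-refl zero          = tt
  rel-refl (suc zero)    = tt
  rel-refl (suc (suc j)) = ≤⇒≤ᵇ (≤-refl {toℕ j})

  rel-antisym : ∀ u v → T (rel u v) → T (rel v u) → u ≡ v
  rel-antisym zero          zero           _  _  = refl
  rel-antisym (suc zero)    (suc zero)     _  _  = refl
  rel-antisym zero          (suc zero)     () _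
  rel-antisym zero          (suc (suc j))  _  ()
  rel-antisym (suc zero)    zero           () _
  rel-antisym (suc zero)    (suc (suc j))  () _
  rel-antisym (suc (suc j)) zero           () _
  rel-antisym (suc (suc j)) (suc zero)     _  ()
  rel-antisym (suc (suc j)) (suc (suc j′)) h₁ h₂ =
    cong (λ i → suc (suc i)) (toℕ-injective (≤-antisym (≤ᵇ⇒≤ _ _ h₁) (≤ᵇ⇒≤ _ _ h₂)))

  -- The only nontrivial compositions go through the chain; x < c_j < y is
  -- impossible because A ≤ A + g.
  rel-trans : ∀ u v w → T (rel u v) → T (rel v w) → T (rel u w)
  rel-trans zero (suc (suc j)) (suc zero) h₁ h₂ =
    ⊥-elim (<-irrefl refl (<-≤-trans (<ᵇ⇒< (toℕ j) A h₂) (≤-trans (m≤m+n A g) (≤ᵇ⇒≤ (A + g) (toℕ j) h₁))))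
  rel-trans zero (suc (suc j)) (suc (suc j′)) h₁ h₂ =
    ≤⇒≤ᵇ (≤-trans (≤ᵇ⇒≤ (A + g) (toℕ j) h₁) (≤ᵇ⇒≤ (toℕ j) (toℕ j′) h₂))
  rel-trans (suc (suc j)) (suc (suc j′)) (suc zero) h₁ h₂ =
    <⇒<ᵇ (≤-<-trans (≤ᵇ⇒≤ (toℕ j) (toℕ j′) h₁) (<ᵇ⇒< (toℕ j′) A h₂))
  rel-trans (suc (suc j)) (suc (suc j′)) (suc (suc j″)) h₁ h₂ =
    ≤⇒≤ᵇ (≤-trans (≤ᵇ⇒≤ (toℕ j) (toℕ j′) h₁) (≤ᵇ⇒≤ (toℕ j′) (toℕ j″) h₂))
  rel-trans zero          zero           w h₁ h₂ = h₂
  rel-trans (suc zero)    (suc zero)     w h₁ h₂ = h₂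
  rel-trans (suc (suc j)) (suc zero)     (suc zero) h₁ h₂ = h₁
  rel-trans zero          (suc zero)     _ () _
  rel-trans zero          (suc (suc j))  zero _ ()
  rel-trans (suc zero)    zero           _ () _
  rel-trans (suc zero)    (suc (suc j))  _ () _
  rel-trans (suc (suc j)) zero           _ () _
  rel-trans (suc (suc j)) (suc zero)     zero _ ()
  rel-trans (suc (suc j)) (suc zero)     (suc (suc _)) _ ()
  rel-trans (suc (suc j)) (suc (suc j′)) zero _ ()

  P : FinPoset (2 + m)
  P = record { _≼_ = rel ; ≼-refl = rel-refl ; ≼-antisym = rel-antisym ; ≼-trans = rel-trans }

  open Completions P

  -- The downsets met while listing P: the chain prefix c₀, …, c_{i-1},
  -- together with x if X and with y if Y.
  state : ℕ → Bool → Bool → Subset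
  state i X Y zero          = X
  state i X Y (suc zero)    = Y
  state i X Y (suc (suc j)) = toℕ j <ᵇ i

  -- x has no predecessors, so it may be listed whenever it is not yet listed.
  addable-x : ∀ i X Y → addable (state i X Y) zero ≡ not X
  addable-x i X Y = trans (cong (not X ∧_) (allᶠ-true {m})) (∧-identityʳ (not X))

  -- y may be listed once c₀, …, c_{A-1} are, i.e. when A ≤ i.
  below-y-listed : ∀ i → allᶠ {m} (λ j → not (toℕ j <ᵇ A) ∨ (false ∨ (toℕ j <ᵇ i))) ≡ (A ≤ᵇ i)
  below-y-listed i = bool-ext listed⇒A≤i A≤i⇒listed
    where
      listed⇒A≤i : T (allᶠ {m} (λ j → not (toℕ j <ᵇ A) ∨ (false ∨ (toℕ j <ᵇ i)))) → T (A ≤ᵇ i)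
      listed⇒A≤i h with A ≤? i
      ... | yes A≤i = ≤⇒≤ᵇ A≤i
      ... | no  A≰i = ⊥-elim (c_i-unlisted (allᶠ-elim {m} _ h (fromℕ< i<m)))
        where
          i<A : i < A
          i<A = ≰⇒> A≰i
          i<m : i < m
          i<m = <-≤-trans i<A (≤-trans (m≤m+n A g) (m≤m+n (A + g) B))
          c_i-unlisted : ¬ T (not (toℕ (fromℕ< i<m) <ᵇ A) ∨ (false ∨ (toℕ (fromℕ< i<m) <ᵇ i)))
          c_i-unlisted rewrite toℕ-fromℕ< i<m | <ᵇ-true i<A | <ᵇ-false {i} {i} (<-irrefl refl) = λ ()
      A≤i⇒listed : T (A ≤ᵇ i) → T (allᶠ {m} (λ j → not (toℕ j <ᵇ A) ∨ (false ∨ (toℕ j <ᵇ i))))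
      A≤i⇒listed h = allᶠ-intro {m} _ λ j → below-listed j (toℕ j <ᵇ A) refl
        where
          below-listed : ∀ j b → (toℕ j <ᵇ A) ≡ b → T (not b ∨ (false ∨ (toℕ j <ᵇ i)))
          below-listed j false _ = tt
          below-listed j true eq = <⇒<ᵇ (<-≤-trans (<ᵇ⇒< (toℕ j) A (true⇒T eq)) (≤ᵇ⇒≤ A i h))

  addable-y : ∀ i X Y → addable (state i X Y) (suc zero) ≡ not Y ∧ (A ≤ᵇ i)
  addable-y i X Y = cong (not Y ∧_) (below-y-listed i)

  chain-preds-listed : ℕ → Fin m → Bool
  chain-preds-listed i j = allᶠ {m} (λ j′ → not (toℕ j′ ≤ᵇ toℕ j) ∨ (does (j′ ≟ j) ∨ (toℕ j′ <ᵇ i)))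

  chain-preds-listed-next : ∀ i j → toℕ j ≡ i → chain-preds-listed i j ≡ true
  chain-preds-listed-next i j j≡i = T⇒true (allᶠ-intro {m} _ λ j′ → listed j′ (toℕ j′ ≤ᵇ toℕ j) refl)
    where
      listed : ∀ j′ b → (toℕ j′ ≤ᵇ toℕ j) ≡ b → T (not b ∨ (does (j′ ≟ j) ∨ (toℕ j′ <ᵇ i)))
      listed j′ false _ = tt
      listed j′ true j′≤j with <-cmp (toℕ j′) i
      ... | tri< j′<i _ _ = from (T-∨ {does (j′ ≟ j)}) (inj₂ (<⇒<ᵇ j′<i))
      ... | tri≈ _ j′≡i _ rewrite toℕ-injective {i = j′} {j = j} (trans j′≡i (sym j≡i)) | dec-true (j ≟ j) refl = tt
      ... | tri> _ _ i<j′ = ⊥-elim (<-irrefl refl (<-≤-trans i<j′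
                              (subst (toℕ j′ ≤_) j≡i (≤ᵇ⇒≤ _ _ (true⇒T j′≤j)))))

  addable-chain-other : ∀ i X Y j → toℕ j ≢ i → addable (state i X Y) (suc (suc j)) ≡ false
  addable-chain-other i X Y j j≢i with <-cmp (toℕ j) i
  ... | tri< j<i _ _ rewrite <ᵇ-true j<i = refl
  ... | tri≈ _ j≡i _ = ⊥-elim (j≢i j≡i)
  ... | tri> _ _ i<j = ¬T⇒false λ h → c_i-unlisted (allᶠ-elim {m} _ (chain-preds h) cᵢ)
    where
      chain-preds : T (addable (state i X Y) (suc (suc j))) → T (chain-preds-listed i j)
      chain-preds h = proj₂ (to (T-∧ {not (A + g ≤ᵇ toℕ j) ∨ (false ∨ X)})
                              (proj₂ (to (T-∧ {not (toℕ j <ᵇ i)}) h)))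
      i<m : i < m
      i<m = <-trans i<j (toℕ<n j)
      cᵢ : Fin m
      cᵢ = fromℕ< i<m
      c_i-unlisted : ¬ T (not (toℕ cᵢ ≤ᵇ toℕ j) ∨ (does (cᵢ ≟ j) ∨ (toℕ cᵢ <ᵇ i)))
      c_i-unlisted
        rewrite dec-false (cᵢ ≟ j) (λ e → j≢i (trans (sym (cong toℕ e)) (toℕ-fromℕ< i<m)))
              | toℕ-fromℕ< i<m | ≤ᵇ-true (<⇒≤ i<j) | <ᵇ-false {i} {i} (<-irrefl refl) = λ ()

  addable-chain-next : ∀ i X Y j → toℕ j ≡ i → addable (state i X Y) (suc (suc j)) ≡ (not (A + g ≤ᵇ i) ∨ X)
  addable-chain-next i X Y j j≡i
    rewrite chain-preds-listed-next i j j≡i | j≡i | <ᵇ-false {i} {i} (<-irrefl refl) = ∧-identityʳ _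

  add-x : ∀ i X Y v → add (state i X Y) zero v ≡ state i true Y v
  add-x i X Y zero          = refl
  add-x i X Y (suc zero)    = refl
  add-x i X Y (suc (suc j)) = refl

  add-y : ∀ i X Y v → add (state i X Y) (suc zero) v ≡ state i X true v
  add-y i X Y zero          = refl
  add-y i X Y (suc zero)    = refl
  add-y i X Y (suc (suc j)) = refl

  add-chain-next : ∀ i X Y j → toℕ j ≡ i → ∀ v → add (state i X Y) (suc (suc j)) v ≡ state (suc i) X Y v
  add-chain-next i X Y j j≡i zero           = refl
  add-chain-next i X Y j j≡i (suc zero)     = refl
  add-chain-next i X Y j j≡i (suc (suc j′)) = bool-ext new⇒listed listed⇒new
    where
      new⇒listed : T (does (j′ ≟ j) ∨ (toℕ j′ <ᵇ i)) → T (toℕ j′ <ᵇ suc i)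
      new⇒listed h with j′ ≟ j
      ... | yes refl rewrite j≡i = <⇒<ᵇ (≤-refl {suc i})
      ... | no  _    = <⇒<ᵇ (m<n⇒m<1+n (<ᵇ⇒< (toℕ j′) i h))
      listed⇒new : T (toℕ j′ <ᵇ suc i) → T (does (j′ ≟ j) ∨ (toℕ j′ <ᵇ i))
      listed⇒new h with <-cmp (toℕ j′) i
      ... | tri< j′<i _ _ = from (T-∨ {does (j′ ≟ j)}) (inj₂ (<⇒<ᵇ j′<i))
      ... | tri≈ _ j′≡i _ rewrite toℕ-injective {i = j′} {j = j} (trans j′≡i (sym j≡i)) | dec-true (j ≟ j) refl = tt
      ... | tri> _ _ i<j′ = ⊥-elim (<-irrefl refl (<-≤-trans i<j′ (≤-pred (<ᵇ⇒< _ _ h))))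

  chain-part : ∀ t i X Y →
    sumᶠ {m} (λ j → if addable (state i X Y) (suc (suc j)) then completions t (add (state i X Y) (suc (suc j))) else 0)
    ≡ (if (i <ᵇ m) ∧ (not (A + g ≤ᵇ i) ∨ X) then completions t (state (suc i) X Y) else 0)
  chain-part t i X Y with i <? m
  ... | yes i<m rewrite <ᵇ-true i<m =
    trans (sumᶠ-single _ cᵢ λ j j≢cᵢ →
             cong (λ b → if b then completions t (add (state i X Y) (suc (suc j))) else 0)
                  (addable-chain-other i X Y j (λ e → j≢cᵢ (toℕ-injective (trans e (sym cᵢ≡i))))))
      (trans (cong (λ b → if b then completions t (add (state i X Y) (suc (suc cᵢ))) else 0)
                   (addable-chain-next i X Y cᵢ cᵢ≡i))
             (cong (λ c → if not (A + g ≤ᵇ i) ∨ X then c else 0)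
                   (completions-cong t _ _ (add-chain-next i X Y cᵢ cᵢ≡i))))
    where
      cᵢ : Fin m
      cᵢ = fromℕ< i<m
      cᵢ≡i : toℕ cᵢ ≡ i
      cᵢ≡i = toℕ-fromℕ< i<m
  ... | no i≮m rewrite <ᵇ-false i≮m =
    sumᶠ-zero _ λ j → cong (λ b → if b then completions t (add (state i X Y) (suc (suc j))) else 0)
      (addable-chain-other i X Y j (λ e → i≮m (subst (_< m) e (toℕ<n j))))

  completions-state : ∀ t i X Y → completions (suc t) (state i X Y) ≡
    (if not X then completions t (state i true Y) else 0) +
    ((if not Y ∧ (A ≤ᵇ i) then completions t (state i X true) else 0) +
     (if (i <ᵇ m) ∧ (not (A + g ≤ᵇ i) ∨ X) then completions t (state (suc i) X Y) else 0))
  completions-state t i X Y = trans (completions-suc t (state i X Y)) (cong₂ _+_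
    (trans (cong (λ b → if b then completions t (add (state i X Y) zero) else 0) (addable-x i X Y))
           (cong (λ c → if not X then c else 0) (completions-cong t _ _ (add-x i X Y))))
    (cong₂ _+_
      (trans (cong (λ b → if b then completions t (add (state i X Y) (suc zero)) else 0) (addable-y i X Y))
             (cong (λ c → if not Y ∧ (A ≤ᵇ i) then c else 0) (completions-cong t _ _ (add-y i X Y))))
      (chain-part t i X Y)))

  x-threshold-to-end : ∀ i e → i + e ≡ A + g → i + (e + B) ≡ m
  x-threshold-to-end i e eq = extend-sum i e B eq

  y-threshold-to-end : ∀ i e → i + e ≡ A → i + (e + (g + B)) ≡ m
  y-threshold-to-end i e eq = trans (extend-sum i e (g + B) eq) (sym (+-assoc A g B))

  -- Closed forms for the number of completions of each state, by induction
  -- along the chain.  Once x and y are both listed, only the chain remains.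
  only-chain-left : ∀ d i → i + d ≡ m → completions d (state i true true) ≡ 1
  only-chain-left zero    i eq = refl
  only-chain-left (suc d) i eq
    rewrite completions-state d i true true | <ᵇ-true (before eq) | ∨-zeroʳ (not (A + g ≤ᵇ i)) =
    only-chain-left d (suc i) (step-along eq)

  -- With x listed and c_{A-1} already passed, y goes into one of the d + 1 gaps left.
  y-left-late : ∀ d i → i + d ≡ m → A ≤ i → completions (suc d) (state i true false) ≡ suc d
  y-left-late zero i eq A≤i
    rewrite completions-state zero i true false | ≤ᵇ-true A≤i | only-chain-left zero i eq
          | <ᵇ-false {i} {m} (<-irrefl (at eq)) = refl
  y-left-late (suc d) i eq A≤i
    rewrite completions-state (suc d) i true false | ≤ᵇ-true A≤i | only-chain-left (suc d) i eq
          | <ᵇ-true (before eq) | ∨-zeroʳ (not (A + g ≤ᵇ i)) =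
    cong suc (y-left-late d (suc i) (step-along eq) (m≤n⇒m≤1+n A≤i))

  -- With x listed and e chain elements to go before y may be listed: g + B + 1 gaps.
  y-left-early : ∀ e i → i + e ≡ A → completions (suc (e + (g + B))) (state i true false) ≡ suc (g + B)
  y-left-early zero i eq =
    y-left-late (g + B) i (y-threshold-to-end i zero eq) (subst (_≤ i) (at eq) ≤-refl)
  y-left-early (suc e) i eq
    rewrite completions-state (suc (e + (g + B))) i true false | ≤ᵇ-false {A} {i} (before eq)
          | <ᵇ-true {i} {m} (before (y-threshold-to-end i (suc e) eq))
          | ∨-zeroʳ (not (A + g ≤ᵇ i)) =
    y-left-early e (suc i) (step-along eq)

  -- With y listed and e chain elements to go up to c_{A+g}: x has e + 1 gaps.
  x-left : ∀ e i → i + e ≡ A + g → completions (suc (e + B)) (state i false true) ≡ suc e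
  x-left zero i eq
    rewrite completions-state (zero + B) i false true | only-chain-left (zero + B) i (x-threshold-to-end i zero eq)
          | ≤ᵇ-true {A + g} {i} (subst (_≤ i) (at eq) ≤-refl) | ∧-zeroʳ (i <ᵇ m) = refl
  x-left (suc e) i eq
    rewrite completions-state (suc e + B) i false true | only-chain-left (suc e + B) i (x-threshold-to-end i (suc e) eq)
          | ≤ᵇ-false {A + g} {i} (before eq) | <ᵇ-true {i} {m} (before (x-threshold-to-end i (suc e) eq)) =
    cong suc (x-left e (suc i) (step-along eq))

  neither-left-late : ∀ e i → i + e ≡ A + g → A ≤ i →
    completions (suc (suc (e + B))) (state i false false) ≡ suc e * suc (suc (B + e))
  neither-left-late zero i eq A≤i
    rewrite completions-state (suc (zero + B)) i false false
          | y-left-late (zero + B) i (x-threshold-to-end i zero eq) A≤i | ≤ᵇ-true A≤i | x-left zero i eq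
          | ≤ᵇ-true {A + g} {i} (subst (_≤ i) (at eq) ≤-refl) | ∧-zeroʳ (i <ᵇ m) = late-base B
    where
      late-base : ∀ B → suc B + (1 + 0) ≡ 1 * suc (suc (B + 0))
      late-base = solve-∀
  neither-left-late (suc e) i eq A≤i
    rewrite completions-state (suc (suc e + B)) i false false
          | y-left-late (suc e + B) i (x-threshold-to-end i (suc e) eq) A≤i | ≤ᵇ-true A≤i | x-left (suc e) i eq
          | ≤ᵇ-false {A + g} {i} (before eq) | <ᵇ-true {i} {m} (before (x-threshold-to-end i (suc e) eq)) =
    trans (cong (λ c → suc (suc e + B) + (suc (suc e) + c)) (neither-left-late e (suc i) (step-along eq) (m≤n⇒m≤1+n A≤i)))
          (late-step B e)
    where
      late-step : ∀ B e → suc (suc e + B) + (suc (suc e) + suc e * suc (suc (B + e))) ≡ suc (suc e) * suc (suc (B + suc e))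
      late-step = solve-∀

  neither-left-early : ∀ e i → i + e ≡ A →
    completions (suc (suc (e + (g + B)))) (state i false false) ≡ e * suc (g + B) + suc g * suc (suc (B + g))
  neither-left-early zero i eq =
    neither-left-late g i (cong (_+ g) (at eq)) (subst (_≤ i) (at eq) ≤-refl)
  neither-left-early (suc e) i eq
    rewrite completions-state (suc (suc e + (g + B))) i false false | y-left-early (suc e) i eq
          | ≤ᵇ-false {A} {i} (before eq) | ≤ᵇ-false {A + g} {i} (<-≤-trans (before eq) (m≤m+n A g))
          | <ᵇ-true {i} {m} (before (y-threshold-to-end i (suc e) eq)) =
    trans (cong (λ c → suc (g + B) + (0 + c)) (neither-left-early e (suc i) (step-along eq)))
          (sym (+-assoc (suc (g + B)) (e * suc (g + B)) _))

  e-family : e P ≡ (A + g + 1) * (g + B + 1) + (g + 1)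
  e-family = begin
    e P                                                   ≡⟨ e≡completions ⟩
    completions (2 + m) (λ _ → false)                     ≡⟨ cong (λ t → completions (2 + t) (λ _ → false)) (+-assoc A g B) ⟩
    completions (2 + (A + (g + B))) (λ _ → false)         ≡⟨ completions-cong (2 + (A + (g + B))) _ _ empty≗start ⟩
    completions (2 + (A + (g + B))) (state 0 false false) ≡⟨ neither-left-early A 0 refl ⟩
    A * suc (g + B) + suc g * suc (suc (B + g))           ≡⟨ closed-form A g B ⟩
    (A + g + 1) * (g + B + 1) + (g + 1)                   ∎
    where
      open ≡-Reasoning
      empty≗start : ∀ v → false ≡ state 0 false false v
      empty≗start zero          = refl
      empty≗start (suc zero)    = refl
      empty≗start (suc (suc j)) = refl
      closed-form : ∀ A g B → A * suc (g + B) + suc g * suc (suc (B + g)) ≡ (A + g + 1) * (g + B + 1) + (g + 1)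
      closed-form = solve-∀

Realisable : ℕ → Set
Realisable n = ∃[ k ] Σ (FinPoset k) (λ P → e P ≡ n × k * k ≤ 4 * n)

by-family : ∀ A g B {n} → (A + g + 1) * (g + B + 1) + (g + 1) ≡ n →
  (2 + (A + g + B)) * (2 + (A + g + B)) ≤ 4 * n → Realisable n
by-family A g B count≡n size≤ = 2 + (A + g + B) , Family.P A g B , trans (Family.e-family A g B) count≡n , size≤

≤-by-slack : ∀ {a c} b → a + b ≡ c → a ≤ c
≤-by-slack {a} b refl = m≤m+n a b

square-decomposition : ∀ n → ∃[ s ] ∃[ r ] n ≡ s * s + r × r ≤ s + s
square-decomposition zero = 0 , 0 , refl , z≤n
square-decomposition (suc n) with square-decomposition n
... | s , r , n≡ , r≤2s with r <? s + s
...   | yes r<2s = s , suc r , trans (cong suc n≡) (sym (+-suc (s * s) r)) , r<2s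
...   | no  r≮2s = suc s , 0 , trans (cong suc n≡) (trans (cong (λ t → suc (s * s + t)) r≡2s) (next-square s)) , z≤n
  where
    r≡2s : r ≡ s + s
    r≡2s = ≤-antisym r≤2s (≮⇒≥ r≮2s)
    next-square : ∀ s → suc (s * s + (s + s)) ≡ suc s * suc s + 0
    next-square = solve-∀

-- n = s²: the empty poset for s = 1, and P(s - 2, 0, s), with 2s elements, for s ≥ 2.
perfect-square : ∀ s → 1 ≤ s * s + 0 → Realisable (s * s + 0)
perfect-square (suc zero)    _ = 0 , empty , refl , z≤n
  where
    empty : FinPoset 0
    empty = record { _≼_ = λ () ; ≼-refl = λ () ; ≼-antisym = λ () ; ≼-trans = λ () }
perfect-square (suc (suc A)) _ = by-family A 0 (2 + A) (extensions A) (≤-by-slack 0 (size A))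
  where
    extensions : ∀ A → (A + 0 + 1) * (0 + (2 + A) + 1) + (0 + 1) ≡ (2 + A) * (2 + A) + 0
    extensions = solve-∀
    size : ∀ A → (2 + (A + 0 + (2 + A))) * (2 + (A + 0 + (2 + A))) + 0 ≡ 4 * ((2 + A) * (2 + A) + 0)
    size = solve-∀

-- n = s² + r with 1 ≤ r ≤ s: P(s - r, r - 1, s - r), with 2s - r + 1 elements.
small-excess : ∀ s g → suc g ≤ s → Realisable (s * s + suc g)
small-excess s g r≤s with m≤n⇒∃[o]m+o≡n r≤s
... | A , refl = by-family A g A (extensions A g) (≤-by-slack (3 * g * g + 4 * A * g + 8 * g + 4) (size A g))
  where
    extensions : ∀ A g → (A + g + 1) * (g + A + 1) + (g + 1) ≡ (suc g + A) * (suc g + A) + suc g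
    extensions = solve-∀
    size : ∀ A g → (2 + (A + g + A)) * (2 + (A + g + A)) + (3 * g * g + 4 * A * g + 8 * g + 4)
                   ≡ 4 * ((suc g + A) * (suc g + A) + suc g)
    size = solve-∀

-- n = s² + r with s < r ≤ 2s: P(2s - r, r - s - 1, 2s - r + 1), with 3s - r + 2 elements.
large-excess : ∀ s g → s < suc g → suc g ≤ s + s → Realisable (s * s + suc g)
large-excess s g s<r r≤2s with m≤n⇒∃[o]m+o≡n (≤-pred s<r)
... | h , refl with m≤n⇒∃[o]m+o≡n (+-cancelˡ-< s h s r≤2s)
...   | A , refl = by-family A h (suc A) (extensions A h) (≤-by-slack (4 * A * h + 3 * h * h + 10 * h + 3) (size A h))
  where
    extensions : ∀ A h → (A + h + 1) * (h + suc A + 1) + (h + 1) ≡ (suc h + A) * (suc h + A) + suc (suc h + A + h)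
    extensions = solve-∀
    size : ∀ A h → (2 + (A + h + suc A)) * (2 + (A + h + suc A)) + (4 * A * h + 3 * h * h + 10 * h + 3)
                   ≡ 4 * ((suc h + A) * (suc h + A) + suc (suc h + A + h))
    size = solve-∀

theorem3p2 : ∀ (n : ℕ) → 1 ≤ n →
    ∃[ k ] Σ (FinPoset k) (λ P → e P ≡ n × k * k ≤ 4 * n)
theorem3p2 n 1≤n with square-decomposition n
... | s , zero  , refl , _    = perfect-square s 1≤n
... | s , suc g , refl , r≤2s with suc g ≤? s
...   | yes r≤s = small-excess s g r≤s
...   | no  r≰s = large-excess s g (≰⇒> r≰s) r≤2s
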